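{- Let $a,b$ be coprime positive integers with $a>b\geqslant 1$ and let $\beta=a/b$. Then parallel addition in base $\beta$ is possible on the alphabet $\mathcal{A}=\{0,1,\ldots,a+b-1\}$.
   Context: For a complex number $\beta$ with $|\beta|>1$ and a finite set $\mathcal{A}\subset\mathbb{C}$ containing $0$, let $\mathrm{Fin}_{\mathcal{A}}(\beta)=\{\sum_{j\in I}x_j\beta^j : I\subset\mathbb{Z}\text{ finite},\ x_j\in\mathcal{A}\}$. For finite alphabets $\mathcal{A},\mathcal{B}$, a map $\varphi:\mathcal{A}^{\mathbb{Z}}\to\mathcal{B}^{\mathbb{Z}}$ is $p$-local if there are integers $r,t\geqslant 0$ with $p=r+t+1$ and a map $\Phi:\mathcal{A}^p\to\mathcal{B}$ such that for every $u=(u_j)$ and $v=\varphi(u)$ one has $v_j=\Phi(u_{j+t}\cdots u_j\cdots u_{j-r})$ for all $j\in\mathbb{Z}$. A digit set conversion in base $\beta$ from $\mathcal{A}$ to $\mathcal{B}$ (both containing $0$) is a map $\varphi:\mathcal{A}^{\mathbb{Z}}\to\mathcal{B}^{\mathbb{Z}}$ such that whenever $u$ has finitely many nonzero entries, $v=\varphi(u)$ has finitely many nonzero entries and $\sum_j v_j\beta^j=\sum_j u_j\beta^j$. Parallel addition in base $\beta$ is possible on $\mathcal{A}$ if there is a digit set conversion in base $\beta$ from $\mathcal{A}+\mathcal{A}=\{x+y:x,y\in\mathcal{A}\}$ to $\mathcal{A}$ that is $p$-local for some $p$. -}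

module Defs where

open import Data.Nat as ℕ using (ℕ; zero; suc; NonZero)
open import Data.Integer as ℤ using (ℤ; +_; -[1+_])
open import Data.Rational using (ℚ; 0ℚ; 1ℚ; _+_; _*_; _/_)
open import Data.Vec using (Vec; []; _∷_)
open import Data.Product using (Σ; ∃; ∃-syntax; _×_; _,_)
open import Relation.Binary.PropositionalEquality using (_≡_)

Alphabet : Set₁
Alphabet = ℚ → Set

Seq : Set
Seq = ℤ → ℚ

_∈Seq_ : Seq → Alphabet → Set
u ∈Seq 𝒜 = ∀ j → 𝒜 (u j)

_⊕_ : Alphabet → Alphabet → Alphabet
(𝒜 ⊕ ℬ) z = ∃[ x ] ∃[ y ] (𝒜 x × ℬ y × z ≡ x + y)

range : ℕ → Alphabet
range n z = ∃[ d ] (d ℕ.< n × z ≡ (+ d) / 1)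

SupportedIn : ℕ → Seq → Set
SupportedIn N u = ∀ j → N ℕ.< ℤ.∣ j ∣ → u j ≡ 0ℚ

FinSupp : Seq → Set
FinSupp u = ∃[ N ] SupportedIn N u

pow : ℚ → ℕ → ℚ
pow x zero = 1ℚ
pow x (suc n) = x * pow x n

-- Integer powers of β, given β and its inverse βi
zpow : (β βi : ℚ) → ℤ → ℚ
zpow β βi (+ n) = pow β n
zpow β βi -[1+ n ] = pow βi (suc n)

sumFrom : (β βi : ℚ) → Seq → ℤ → ℕ → ℚ
sumFrom β βi u j zero = 0ℚ
sumFrom β βi u j (suc k) = u j * zpow β βi j + sumFrom β βi u (ℤ.suc j) k

value : (β βi : ℚ) → ℕ → Seq → ℚ
value β βi N u = sumFrom β βi u (ℤ.- (+ N)) (suc (N ℕ.+ N))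

window : (r t : ℕ) → Seq → ℤ → Vec ℚ (r ℕ.+ t ℕ.+ 1)
window r t u j = go (r ℕ.+ t ℕ.+ 1) (j ℤ.+ + t)
  where
  go : (n : ℕ) → ℤ → Vec ℚ n
  go zero i = []
  go (suc n) i = u i ∷ go n (ℤ.pred i)

slide : (r t : ℕ) → (Vec ℚ (r ℕ.+ t ℕ.+ 1) → ℚ) → Seq → Seq
slide r t Φ u j = Φ (window r t u j)

IsDigitSetConversion : (β βi : ℚ) (𝒜 ℬ : Alphabet) (φ : Seq → Seq) → Set
IsDigitSetConversion β βi 𝒜 ℬ φ =
  (∀ u → u ∈Seq 𝒜 → φ u ∈Seq ℬ) ×
  (∀ u → u ∈Seq 𝒜 → (N : ℕ) → SupportedIn N u →
     ∃[ M ] (SupportedIn M (φ u) × value β βi M (φ u) ≡ value β βi N u))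

IsLocal : (p : ℕ) (𝒜 : Alphabet) (φ : Seq → Seq) → Set
IsLocal p 𝒜 φ = ∃[ r ] ∃[ t ] Σ (p ≡ r ℕ.+ t ℕ.+ 1) λ _ →
  ∃[ Φ ] (∀ u → u ∈Seq 𝒜 → ∀ j → φ u j ≡ slide r t Φ u j)

ParallelAddition : (β βi : ℚ) (𝒜 : Alphabet) → Set
ParallelAddition β βi 𝒜 = ∃[ φ ] ∃[ p ]
  (IsDigitSetConversion β βi (𝒜 ⊕ 𝒜) 𝒜 φ × IsLocal p (𝒜 ⊕ 𝒜) φ)

-- A digit x at position i is replaced by x − a·c_i + b·c_{i−1}, where the carry c_i is 1 when x
-- reaches a threshold T ≥ a and 0 otherwise.  Since b·β^i = a·β^(i−1), this keeps the value, and as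
-- b < a a digit x ≤ T + b becomes a digit < T + b.  Running this with T = a + m − 1, …, a + 1, a
-- lowers the digit bound from 2(a+b) to a + b in m = a + b rounds, and each round only looks at
-- one more digit to the right, so the composite is a sliding block map with memory a + b.
module Submission where

open import Defs
open import Data.Nat using (ℕ; _<_; _≤_; _+_; NonZero)
open import Data.Nat.Coprimality using (Coprime)
open import Data.Integer using (+_)
open import Data.Rational using (_/_)

open import Algebra.Bundles using (CommutativeMonoid)
import Algebra.Properties.CommutativeSemigroup as CommSemigroupProperties
open import Data.Integer as ℤ using (ℤ; -[1+_])
import Data.Integer.Properties as ℤP
import Data.Integer.Tactic.RingSolver as ℤ-Solver
open import Data.List as List using (List; []; _∷_)
open import Data.Empty using (⊥-elim)
open import Data.Maybe using (fromMaybe)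
open import Data.Nat using (zero; suc; _*_; _∸_; z≤n; s≤s; _≤?_)
import Data.Nat.Coprimality as Coprimality
open import Data.Nat.Properties
open import Data.Product using (_×_; _,_; proj₁; proj₂; ∃-syntax)
open import Data.Rational as ℚ using (ℚ; mkℚ; 0ℚ; 1ℚ; toℚᵘ)
import Data.Rational.Properties as ℚP
open import Data.Rational.Unnormalised as ℚᵘ using (mkℚᵘ; *≡*; _≃_)
import Data.Rational.Unnormalised.Properties as ℚᵘP
open import Data.Sum using (_⊎_; inj₁; inj₂)
open import Data.Vec as Vec using ()
open import Function using (_∘_)
open import Relation.Nullary using (yes; no)
open import Relation.Binary.PropositionalEquality

fromℕ : ℕ → ℚ
fromℕ n = + n / 1

toℕ : ℚ → ℕ
toℕ q = ℤ.∣ ℚ.↥ q ∣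

toℕ-fromℕ : ∀ n → toℕ (fromℕ n) ≡ n
toℕ-fromℕ n = cong toℕ (ℚP.↥p/↧p≡p (mkℚ (+ n) 0 (Coprimality.sym (Coprimality.1-coprimeTo n))))

toℚᵘ-/ : ∀ n d → toℚᵘ (+ n / suc d) ≃ mkℚᵘ (+ n) d
toℚᵘ-/ n d = ℚP.toℚᵘ-fromℚᵘ (mkℚᵘ (+ n) d)

fromℕ-+ : ∀ m n → fromℕ (m + n) ≡ fromℕ m ℚ.+ fromℕ n
fromℕ-+ m n = ℚP.toℚᵘ-injective (begin
  toℚᵘ (fromℕ (m + n))                 ≈⟨ toℚᵘ-/ (m + n) 0 ⟩
  mkℚᵘ (+ (m + n)) 0                   ≈⟨ *≡* (trans (cong (ℤ._* + 1) (ℤP.pos-+ m n)) (cross (+ m) (+ n))) ⟩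
  mkℚᵘ (+ m) 0 ℚᵘ.+ mkℚᵘ (+ n) 0       ≈⟨ ℚᵘP.+-cong (toℚᵘ-/ m 0) (toℚᵘ-/ n 0) ⟨
  toℚᵘ (fromℕ m) ℚᵘ.+ toℚᵘ (fromℕ n)   ≈⟨ ℚP.toℚᵘ-homo-+ (fromℕ m) (fromℕ n) ⟨
  toℚᵘ (fromℕ m ℚ.+ fromℕ n)           ∎)
  where
  open ℚᵘP.≃-Reasoning
  cross : ∀ x y → (x ℤ.+ y) ℤ.* + 1 ≡ (x ℤ.* + 1 ℤ.+ y ℤ.* + 1) ℤ.* + 1
  cross = ℤ-Solver.solve-∀

fromℕ-* : ∀ m n → fromℕ (m * n) ≡ fromℕ m ℚ.* fromℕ n
fromℕ-* m n = ℚP.toℚᵘ-injective (begin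
  toℚᵘ (fromℕ (m * n))                 ≈⟨ toℚᵘ-/ (m * n) 0 ⟩
  mkℚᵘ (+ (m * n)) 0                   ≈⟨ *≡* (cong (ℤ._* + 1) (ℤP.pos-* m n)) ⟩
  mkℚᵘ (+ m) 0 ℚᵘ.* mkℚᵘ (+ n) 0       ≈⟨ ℚᵘP.*-cong (toℚᵘ-/ m 0) (toℚᵘ-/ n 0) ⟨
  toℚᵘ (fromℕ m) ℚᵘ.* toℚᵘ (fromℕ n)   ≈⟨ ℚP.toℚᵘ-homo-* (fromℕ m) (fromℕ n) ⟨
  toℚᵘ (fromℕ m ℚ.* fromℕ n)           ∎)
  where open ℚᵘP.≃-Reasoning

fromℕ-*-/ : ∀ n d → fromℕ (suc d) ℚ.* (+ n / suc d) ≡ fromℕ n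
fromℕ-*-/ n d = ℚP.toℚᵘ-injective (begin
  toℚᵘ (fromℕ (suc d) ℚ.* (+ n / suc d))       ≈⟨ ℚP.toℚᵘ-homo-* (fromℕ (suc d)) (+ n / suc d) ⟩
  toℚᵘ (fromℕ (suc d)) ℚᵘ.* toℚᵘ (+ n / suc d) ≈⟨ ℚᵘP.*-cong (toℚᵘ-/ (suc d) 0) (toℚᵘ-/ n d) ⟩
  mkℚᵘ (+ suc d) 0 ℚᵘ.* mkℚᵘ (+ n) d           ≈⟨ *≡* (cancel (+ suc d) (+ n)) ⟩
  mkℚᵘ (+ n) 0                                 ≈⟨ toℚᵘ-/ n 0 ⟨
  toℚᵘ (fromℕ n)                               ∎)
  where
  open ℚᵘP.≃-Reasoning
  cancel : ∀ x y → x ℤ.* y ℤ.* + 1 ≡ y ℤ.* (+ 1 ℤ.* x)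
  cancel = ℤ-Solver.solve-∀

fromℕ-*-assoc : ∀ m n z → fromℕ (m * n) ℚ.* z ≡ fromℕ n ℚ.* (fromℕ m ℚ.* z)
fromℕ-*-assoc m n z = begin
  fromℕ (m * n) ℚ.* z             ≡⟨ cong (λ k → fromℕ k ℚ.* z) (*-comm m n) ⟩
  fromℕ (n * m) ℚ.* z             ≡⟨ cong (ℚ._* z) (fromℕ-* n m) ⟩
  fromℕ n ℚ.* fromℕ m ℚ.* z       ≡⟨ ℚP.*-assoc (fromℕ n) (fromℕ m) z ⟩
  fromℕ n ℚ.* (fromℕ m ℚ.* z)     ∎
  where open ≡-Reasoning

suc-+-comm : ∀ j k → ℤ.suc j ℤ.+ + k ≡ j ℤ.+ + suc k
suc-+-comm j k = lemma j (+ k)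
  where
  lemma : ∀ x y → (ℤ.1ℤ ℤ.+ x) ℤ.+ y ≡ x ℤ.+ (ℤ.1ℤ ℤ.+ y)
  lemma = ℤ-Solver.solve-∀

toℕ-range-⊕ : ∀ {n z} → (range n ⊕ range n) z → toℕ z < n + n × fromℕ (toℕ z) ≡ z
toℕ-range-⊕ {n} {z} (x , y , (d , d<n , x≡d) , (e , e<n , y≡e) , z≡x+y) =
  subst (_< n + n) (sym toℕz≡d+e) (+-mono-< d<n e<n) , trans (cong fromℕ toℕz≡d+e) (sym z≡d+e)
  where
  z≡d+e : z ≡ fromℕ (d + e)
  z≡d+e = trans z≡x+y (trans (cong₂ ℚ._+_ x≡d y≡e) (sym (fromℕ-+ d e)))
  toℕz≡d+e : toℕ z ≡ d + e
  toℕz≡d+e = trans (cong toℕ z≡d+e) (toℕ-fromℕ (d + e))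

-n+suc[n+n]≡suc[n] : ∀ n → ℤ.- + n ℤ.+ + suc (n + n) ≡ + suc n
-n+suc[n+n]≡suc[n] n = trans (cong (λ k → ℤ.- + n ℤ.+ (ℤ.1ℤ ℤ.+ k)) (ℤP.pos-+ n n)) (lemma (+ n))
  where
  lemma : ∀ x → ℤ.- x ℤ.+ (ℤ.1ℤ ℤ.+ (x ℤ.+ x)) ≡ ℤ.1ℤ ℤ.+ x
  lemma = ℤ-Solver.solve-∀

suc<∣∣⇒<∣pred∣ : ∀ K j → suc K < ℤ.∣ j ∣ → K < ℤ.∣ ℤ.pred j ∣
suc<∣∣⇒<∣pred∣ K (+ suc n) (s≤s K<n) = K<n
suc<∣∣⇒<∣pred∣ K -[1+ n ]  K+1<n+1 = m<n⇒m<1+n (<-trans (n<1+n K) K+1<n+1)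

module _ (β βi : ℚ) where

  sumFrom-cong : ∀ {u v : Seq} → (∀ i → u i ≡ v i) → ∀ j k → sumFrom β βi u j k ≡ sumFrom β βi v j k
  sumFrom-cong u≡v j zero    = refl
  sumFrom-cong u≡v j (suc k) =
    cong₂ ℚ._+_ (cong (ℚ._* zpow β βi j) (u≡v j)) (sumFrom-cong u≡v (ℤ.suc j) k)

  value-cong : ∀ {u v : Seq} → (∀ i → u i ≡ v i) → ∀ N → value β βi N u ≡ value β βi N v
  value-cong u≡v N = sumFrom-cong u≡v (ℤ.- + N) (suc (N + N))

  sumFrom-suc : ∀ (u : Seq) j k →
    sumFrom β βi u j (suc k) ≡ sumFrom β βi u j k ℚ.+ u (j ℤ.+ + k) ℚ.* zpow β βi (j ℤ.+ + k)
  sumFrom-suc u j zero = begin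
    u j ℚ.* zpow β βi j ℚ.+ 0ℚ                       ≡⟨ ℚP.+-identityʳ _ ⟩
    u j ℚ.* zpow β βi j                              ≡⟨ cong (λ i → u i ℚ.* zpow β βi i) (ℤP.+-identityʳ j) ⟨
    u (j ℤ.+ + 0) ℚ.* zpow β βi (j ℤ.+ + 0)          ≡⟨ ℚP.+-identityˡ _ ⟨
    0ℚ ℚ.+ u (j ℤ.+ + 0) ℚ.* zpow β βi (j ℤ.+ + 0)   ∎
    where open ≡-Reasoning
  sumFrom-suc u j (suc k) = begin
    t j ℚ.+ sumFrom β βi u (ℤ.suc j) (suc k)
      ≡⟨ cong (t j ℚ.+_) (sumFrom-suc u (ℤ.suc j) k) ⟩
    t j ℚ.+ (sumFrom β βi u (ℤ.suc j) k ℚ.+ t (ℤ.suc j ℤ.+ + k))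
      ≡⟨ ℚP.+-assoc (t j) _ _ ⟨
    t j ℚ.+ sumFrom β βi u (ℤ.suc j) k ℚ.+ t (ℤ.suc j ℤ.+ + k)
      ≡⟨ cong (λ i → t j ℚ.+ sumFrom β βi u (ℤ.suc j) k ℚ.+ t i) (suc-+-comm j k) ⟩
    t j ℚ.+ sumFrom β βi u (ℤ.suc j) k ℚ.+ t (j ℤ.+ + suc k) ∎
    where
    open ≡-Reasoning
    t : ℤ → ℚ
    t i = u i ℚ.* zpow β βi i

  value-suc : ∀ {N} {u : Seq} → SupportedIn N u → value β βi (suc N) u ≡ value β βi N u
  value-suc {N} {u} supp = begin
    u -[1+ N ] ℚ.* zpow β βi -[1+ N ] ℚ.+ sumFrom β βi u (ℤ.suc -[1+ N ]) (suc (N + suc N))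
      ≡⟨ cong₂ ℚ._+_ (vanish -[1+ N ] (n<1+n N)) (cong₂ (sumFrom β βi u) (suc-neg N) (cong suc (+-suc N N))) ⟩
    0ℚ ℚ.+ sumFrom β βi u (ℤ.- + N) (suc (suc (N + N)))
      ≡⟨ ℚP.+-identityˡ _ ⟩
    sumFrom β βi u (ℤ.- + N) (suc (suc (N + N)))
      ≡⟨ sumFrom-suc u (ℤ.- + N) (suc (N + N)) ⟩
    value β βi N u ℚ.+ u (ℤ.- + N ℤ.+ + suc (N + N)) ℚ.* zpow β βi (ℤ.- + N ℤ.+ + suc (N + N))
      ≡⟨ cong (λ i → value β βi N u ℚ.+ u i ℚ.* zpow β βi i) (-n+suc[n+n]≡suc[n] N) ⟩
    value β βi N u ℚ.+ u (+ suc N) ℚ.* zpow β βi (+ suc N)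
      ≡⟨ cong (value β βi N u ℚ.+_) (vanish (+ suc N) (n<1+n N)) ⟩
    value β βi N u ℚ.+ 0ℚ
      ≡⟨ ℚP.+-identityʳ _ ⟩
    value β βi N u ∎
    where
    open ≡-Reasoning
    vanish : ∀ i → N < ℤ.∣ i ∣ → u i ℚ.* zpow β βi i ≡ 0ℚ
    vanish i N<∣i∣ = trans (cong (ℚ._* zpow β βi i) (supp i N<∣i∣)) (ℚP.*-zeroˡ (zpow β βi i))
    suc-neg : ∀ n → ℤ.suc -[1+ n ] ≡ ℤ.- + n
    suc-neg zero    = refl
    suc-neg (suc n) = refl

  sumFrom-telescope : ∀ (u v : Seq) (P : ℤ → ℚ) →
    (∀ i → u i ℚ.* zpow β βi i ℚ.+ P i ≡ v i ℚ.* zpow β βi i ℚ.+ P (ℤ.pred i)) →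
    ∀ j k → sumFrom β βi u j k ℚ.+ P (ℤ.pred (j ℤ.+ + k)) ≡ sumFrom β βi v j k ℚ.+ P (ℤ.pred j)
  sumFrom-telescope u v P local j zero = cong (λ i → 0ℚ ℚ.+ P (ℤ.pred i)) (ℤP.+-identityʳ j)
  sumFrom-telescope u v P local j (suc k) = begin
    s u j ℚ.+ Σu ℚ.+ P (ℤ.pred (j ℤ.+ + suc k))
      ≡⟨ cong (λ i → s u j ℚ.+ Σu ℚ.+ P (ℤ.pred i)) (suc-+-comm j k) ⟨
    s u j ℚ.+ Σu ℚ.+ P (ℤ.pred (ℤ.suc j ℤ.+ + k))
      ≡⟨ ℚP.+-assoc (s u j) Σu _ ⟩
    s u j ℚ.+ (Σu ℚ.+ P (ℤ.pred (ℤ.suc j ℤ.+ + k)))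
      ≡⟨ cong (s u j ℚ.+_) (sumFrom-telescope u v P local (ℤ.suc j) k) ⟩
    s u j ℚ.+ (Σv ℚ.+ P (ℤ.pred (ℤ.suc j)))
      ≡⟨ cong (λ i → s u j ℚ.+ (Σv ℚ.+ P i)) (ℤP.pred-suc j) ⟩
    s u j ℚ.+ (Σv ℚ.+ P j)
      ≡⟨ x∙yz≈xz∙y (s u j) Σv (P j) ⟩
    s u j ℚ.+ P j ℚ.+ Σv
      ≡⟨ cong (ℚ._+ Σv) (local j) ⟩
    s v j ℚ.+ P (ℤ.pred j) ℚ.+ Σv
      ≡⟨ xy∙z≈xz∙y (s v j) (P (ℤ.pred j)) Σv ⟩
    s v j ℚ.+ Σv ℚ.+ P (ℤ.pred j) ∎
    where
    open ≡-Reasoning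
    open CommSemigroupProperties (CommutativeMonoid.commutativeSemigroup ℚP.+-0-commutativeMonoid)
      using (x∙yz≈xz∙y; xy∙z≈xz∙y)
    s : Seq → ℤ → ℚ
    s w i = w i ℚ.* zpow β βi i
    Σu Σv : ℚ
    Σu = sumFrom β βi u (ℤ.suc j) k
    Σv = sumFrom β βi v (ℤ.suc j) k

  value-telescope : ∀ {N} (u v : Seq) (P : ℤ → ℚ) →
    (∀ i → u i ℚ.* zpow β βi i ℚ.+ P i ≡ v i ℚ.* zpow β βi i ℚ.+ P (ℤ.pred i)) →
    P -[1+ N ] ≡ 0ℚ → P (+ N) ≡ 0ℚ → value β βi N u ≡ value β βi N v
  value-telescope {N} u v P local P₋≡0 P₊≡0 = begin
    value β βi N u
      ≡⟨ ℚP.+-identityʳ _ ⟨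
    value β βi N u ℚ.+ 0ℚ
      ≡⟨ cong (value β βi N u ℚ.+_) (trans (cong (P ∘ ℤ.pred) (-n+suc[n+n]≡suc[n] N)) P₊≡0) ⟨
    value β βi N u ℚ.+ P (ℤ.pred (ℤ.- + N ℤ.+ + suc (N + N)))
      ≡⟨ sumFrom-telescope u v P local (ℤ.- + N) (suc (N + N)) ⟩
    value β βi N v ℚ.+ P (ℤ.pred (ℤ.- + N))
      ≡⟨ cong (value β βi N v ℚ.+_) (trans (cong P (sym (ℤP.neg-suc N))) P₋≡0) ⟩
    value β βi N v ℚ.+ 0ℚ
      ≡⟨ ℚP.+-identityʳ _ ⟩
    value β βi N v ∎
    where open ≡-Reasoning

zpow-pred : ∀ {a b : ℕ} {β βi : ℚ} → fromℕ b ℚ.* β ≡ fromℕ a → fromℕ a ℚ.* βi ≡ fromℕ b →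
  ∀ i → fromℕ b ℚ.* zpow β βi i ≡ fromℕ a ℚ.* zpow β βi (ℤ.pred i)
zpow-pred {a} {b} {β} {βi} bβ≡a aβi≡b (+ zero) =
  trans (cong (ℚ._* 1ℚ) (sym aβi≡b)) (ℚP.*-assoc (fromℕ a) βi 1ℚ)
zpow-pred {a} {b} {β} {βi} bβ≡a aβi≡b (+ suc n) =
  trans (sym (ℚP.*-assoc (fromℕ b) β (pow β n))) (cong (ℚ._* pow β n) bβ≡a)
zpow-pred {a} {b} {β} {βi} bβ≡a aβi≡b -[1+ n ] =
  trans (cong (ℚ._* pow βi (suc n)) (sym aβi≡b)) (ℚP.*-assoc (fromℕ a) βi (pow βi (suc n)))

SupportedInℕ : ℕ → (ℤ → ℕ) → Set
SupportedInℕ N s = ∀ j → N < ℤ.∣ j ∣ → s j ≡ 0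

pastWindow : ∀ {A : Set} → (ℤ → A) → ℤ → ℕ → List A
pastWindow s j zero    = []
pastWindow s j (suc n) = s j ∷ pastWindow s (ℤ.pred j) n

map-pastWindow : ∀ {A B : Set} (f : A → B) (s : ℤ → A) j n →
  List.map f (pastWindow s j n) ≡ pastWindow (f ∘ s) j n
map-pastWindow f s j zero    = refl
map-pastWindow f s j (suc n) = cong (f (s j) ∷_) (map-pastWindow f s (ℤ.pred j) n)

window-suc : ∀ r (u : Seq) j → window (suc r) 0 u j ≡ u (j ℤ.+ + 0) Vec.∷ window r 0 u (ℤ.pred j)
window-suc r u -[1+ n ]   = refl
window-suc r u (+ zero)   = refl
window-suc r u (+ suc n)  = refl

toList-window : ∀ r (u : Seq) j → Vec.toList (window r 0 u j) ≡ pastWindow u j (r + 0 + 1)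
toList-window zero    u j = cong (λ i → u i ∷ []) (ℤP.+-identityʳ j)
toList-window (suc r) u j = begin
  Vec.toList (window (suc r) 0 u j)
    ≡⟨ cong Vec.toList (window-suc r u j) ⟩
  u (j ℤ.+ + 0) ∷ Vec.toList (window r 0 u (ℤ.pred j))
    ≡⟨ cong₂ _∷_ (cong u (ℤP.+-identityʳ j)) (toList-window r u (ℤ.pred j)) ⟩
  u j ∷ pastWindow u (ℤ.pred j) (r + 0 + 1) ∎
  where open ≡-Reasoning

module Carry (a b : ℕ) (b<a : b < a) where

  carry : ℕ → ℕ → ℕ
  carry T x with T ≤? x
  ... | yes _ = 1
  ... | no  _ = 0

  carry-cases : ∀ T x → (T ≤ x × carry T x ≡ 1) ⊎ (x < T × carry T x ≡ 0)
  carry-cases T x with T ≤? x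
  ... | yes T≤x = inj₁ (T≤x , refl)
  ... | no  T≰x = inj₂ (≰⇒> T≰x , refl)

  b*carry≤b : ∀ T x → b * carry T x ≤ b
  b*carry≤b T x with carry-cases T x
  ... | inj₁ (_ , c≡1) = ≤-reflexive (trans (cong (b *_) c≡1) (*-identityʳ b))
  ... | inj₂ (_ , c≡0) = ≤-trans (≤-reflexive (trans (cong (b *_) c≡0) (*-zeroʳ b))) z≤n

  step : ℕ → ℕ → ℕ → ℕ
  step T x x′ = x + b * carry T x′ ∸ a * carry T x

  a*carry≤ : ∀ T x x′ → a ≤ T → a * carry T x ≤ x + b * carry T x′
  a*carry≤ T x x′ a≤T with carry-cases T x
  ... | inj₁ (T≤x , c≡1) rewrite c≡1 = ≤-trans (≤-reflexive (*-identityʳ a)) (≤-trans (≤-trans a≤T T≤x) (m≤m+n x _))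
  ... | inj₂ (_   , c≡0) rewrite c≡0 = ≤-trans (≤-reflexive (*-zeroʳ a)) z≤n

  step-+ : ∀ T x x′ → a ≤ T → step T x x′ + a * carry T x ≡ x + b * carry T x′
  step-+ T x x′ a≤T = m∸n+n≡m (a*carry≤ T x x′ a≤T)

  step-< : ∀ T x x′ → a ≤ T → x ≤ T + b → step T x x′ < T + b
  step-< T x x′ a≤T x≤T+b with carry-cases T x | step-+ T x x′ a≤T
  ... | inj₁ (_ , c≡1) | exact = +-cancelʳ-< a (step T x x′) (T + b) (begin-strict
    step T x x′ + a               ≡⟨ cong (_+_ (step T x x′)) (trans (cong (a *_) c≡1) (*-identityʳ a)) ⟨
    step T x x′ + a * carry T x   ≡⟨ exact ⟩
    x + b * carry T x′            ≤⟨ +-mono-≤ x≤T+b (b*carry≤b T x′) ⟩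
    T + b + b                     <⟨ +-monoʳ-< (T + b) b<a ⟩
    T + b + a                     ∎)
    where open ≤-Reasoning
  ... | inj₂ (x<T , c≡0) | exact = begin-strict
    step T x x′                   ≡⟨ +-identityʳ _ ⟨
    step T x x′ + 0               ≡⟨ cong (_+_ (step T x x′)) (trans (cong (a *_) c≡0) (*-zeroʳ a)) ⟨
    step T x x′ + a * carry T x   ≡⟨ exact ⟩
    x + b * carry T x′            <⟨ +-mono-<-≤ x<T (b*carry≤b T x′) ⟩
    T + b                         ∎
    where open ≤-Reasoning

  carry-0 : ∀ T → 1 ≤ T → carry T 0 ≡ 0
  carry-0 T 1≤T with carry-cases T 0
  ... | inj₁ (T≤0 , _)  = ⊥-elim (<⇒≱ 1≤T T≤0)
  ... | inj₂ (_ , c≡0)  = c≡0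

  step-0-0 : ∀ T → 1 ≤ T → step T 0 0 ≡ 0
  step-0-0 T 1≤T rewrite carry-0 T 1≤T | *-zeroʳ a | *-zeroʳ b = refl

  stepSeq : ℕ → (ℤ → ℕ) → ℤ → ℕ
  stepSeq T s j = step T (s j) (s (ℤ.pred j))

  stepSeq-supported : ∀ {T K s} → 1 ≤ T → SupportedInℕ K s → SupportedInℕ (suc K) (stepSeq T s)
  stepSeq-supported {T} {K} {s} 1≤T supp j K+1<∣j∣
    rewrite supp j (<-trans (n<1+n K) K+1<∣j∣) | supp (ℤ.pred j) (suc<∣∣⇒<∣pred∣ K j K+1<∣j∣) =
    step-0-0 T 1≤T

  rounds : ℕ → (ℤ → ℕ) → ℤ → ℕ
  rounds zero    s = s
  rounds (suc m) s = rounds m (stepSeq (m + a) s)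

  1≤a : 1 ≤ a
  1≤a = ≤-trans (s≤s z≤n) b<a

  1≤m+a : ∀ m → 1 ≤ m + a
  1≤m+a m = ≤-trans 1≤a (m≤n+m a m)

  rounds-< : ∀ m s → (∀ j → s j < m + a + b) → ∀ j → rounds m s j < a + b
  rounds-< zero    s s< = s<
  rounds-< (suc m) s s< = rounds-< m (stepSeq (m + a) s)
    (λ j → step-< (m + a) (s j) (s (ℤ.pred j)) (m≤n+m a m) (≤-pred (s< j)))

  rounds-supported : ∀ m {K s} → SupportedInℕ K s → SupportedInℕ (m + K) (rounds m s)
  rounds-supported zero    supp = supp
  rounds-supported (suc m) {K} {s} supp =
    subst (λ N → SupportedInℕ N (rounds (suc m) s)) (+-suc m K)
      (rounds-supported m (stepSeq-supported (1≤m+a m) supp))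

  stepList : ℕ → List ℕ → List ℕ
  stepList T (x ∷ x′ ∷ xs) = step T x x′ ∷ stepList T (x′ ∷ xs)
  stepList T _             = []

  roundsList : ℕ → List ℕ → List ℕ
  roundsList zero    l = l
  roundsList (suc m) l = roundsList m (stepList (m + a) l)

  stepList-pastWindow : ∀ T s j n → stepList T (pastWindow s j (suc n)) ≡ pastWindow (stepSeq T s) j n
  stepList-pastWindow T s j zero    = refl
  stepList-pastWindow T s j (suc n) = cong (stepSeq T s j ∷_) (stepList-pastWindow T s (ℤ.pred j) n)

  roundsList-pastWindow : ∀ m s j n → roundsList m (pastWindow s j (m + n)) ≡ pastWindow (rounds m s) j n
  roundsList-pastWindow zero    s j n = refl
  roundsList-pastWindow (suc m) s j n =
    trans (cong (roundsList m) (stepList-pastWindow (m + a) s j (m + n)))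
          (roundsList-pastWindow m (stepSeq (m + a) s) j n)

  module Value {β βi : ℚ} (bβ≡a : fromℕ b ℚ.* β ≡ fromℕ a) (aβi≡b : fromℕ a ℚ.* βi ≡ fromℕ b) where

    valueℕ : ℕ → (ℤ → ℕ) → ℚ
    valueℕ N s = value β βi N (fromℕ ∘ s)

    exchange-value : ∀ {v x c c′} → v + a * c ≡ x + b * c′ → ∀ i →
      fromℕ v ℚ.* zpow β βi i ℚ.+ fromℕ (a * c) ℚ.* zpow β βi i ≡
      fromℕ x ℚ.* zpow β βi i ℚ.+ fromℕ (a * c′) ℚ.* zpow β βi (ℤ.pred i)
    exchange-value {v} {x} {c} {c′} eq i = begin
      fromℕ v ℚ.* z ℚ.+ fromℕ (a * c) ℚ.* z
        ≡⟨ ℚP.*-distribʳ-+ z (fromℕ v) (fromℕ (a * c)) ⟨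
      (fromℕ v ℚ.+ fromℕ (a * c)) ℚ.* z
        ≡⟨ cong (ℚ._* z) (fromℕ-+ v (a * c)) ⟨
      fromℕ (v + a * c) ℚ.* z
        ≡⟨ cong (λ n → fromℕ n ℚ.* z) eq ⟩
      fromℕ (x + b * c′) ℚ.* z
        ≡⟨ cong (ℚ._* z) (fromℕ-+ x (b * c′)) ⟩
      (fromℕ x ℚ.+ fromℕ (b * c′)) ℚ.* z
        ≡⟨ ℚP.*-distribʳ-+ z (fromℕ x) (fromℕ (b * c′)) ⟩
      fromℕ x ℚ.* z ℚ.+ fromℕ (b * c′) ℚ.* z
        ≡⟨ cong (fromℕ x ℚ.* z ℚ.+_) (fromℕ-*-assoc b c′ z) ⟩
      fromℕ x ℚ.* z ℚ.+ fromℕ c′ ℚ.* (fromℕ b ℚ.* z)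
        ≡⟨ cong (λ t → fromℕ x ℚ.* z ℚ.+ fromℕ c′ ℚ.* t) (zpow-pred {a} {b} bβ≡a aβi≡b i) ⟩
      fromℕ x ℚ.* z ℚ.+ fromℕ c′ ℚ.* (fromℕ a ℚ.* z′)
        ≡⟨ cong (fromℕ x ℚ.* z ℚ.+_) (fromℕ-*-assoc a c′ z′) ⟨
      fromℕ x ℚ.* z ℚ.+ fromℕ (a * c′) ℚ.* z′ ∎
      where
      open ≡-Reasoning
      z z′ : ℚ
      z  = zpow β βi i
      z′ = zpow β βi (ℤ.pred i)

    stepSeq-value : ∀ {T K s} → a ≤ T → SupportedInℕ K s → valueℕ (suc K) (stepSeq T s) ≡ valueℕ K s
    stepSeq-value {T} {K} {s} a≤T supp = begin
      valueℕ (suc K) (stepSeq T s)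
        ≡⟨ value-telescope β βi (fromℕ ∘ stepSeq T s) (fromℕ ∘ s) P local
             (P-vanishes (<-trans (n<1+n K) (n<1+n (suc K)))) (P-vanishes (n<1+n K)) ⟩
      valueℕ (suc K) s
        ≡⟨ value-suc β βi (λ j K<∣j∣ → cong fromℕ (supp j K<∣j∣)) ⟩
      valueℕ K s ∎
      where
      open ≡-Reasoning
      P : ℤ → ℚ
      P i = fromℕ (a * carry T (s i)) ℚ.* zpow β βi i
      local : ∀ i → fromℕ (stepSeq T s i) ℚ.* zpow β βi i ℚ.+ P i ≡ fromℕ (s i) ℚ.* zpow β βi i ℚ.+ P (ℤ.pred i)
      local i = exchange-value (step-+ T (s i) (s (ℤ.pred i)) a≤T) i
      P-vanishes : ∀ {i} → K < ℤ.∣ i ∣ → P i ≡ 0ℚ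
      P-vanishes {i} K<∣i∣ rewrite supp i K<∣i∣ | carry-0 T (≤-trans 1≤a a≤T) | *-zeroʳ a =
        ℚP.*-zeroˡ (zpow β βi i)

    rounds-value : ∀ m {K s} → SupportedInℕ K s → valueℕ (m + K) (rounds m s) ≡ valueℕ K s
    rounds-value zero    supp = refl
    rounds-value (suc m) {K} {s} supp = begin
      valueℕ (suc m + K) (rounds (suc m) s)
        ≡⟨ cong (λ N → valueℕ N (rounds (suc m) s)) (+-suc m K) ⟨
      valueℕ (m + suc K) (rounds m (stepSeq (m + a) s))
        ≡⟨ rounds-value m (stepSeq-supported (1≤m+a m) supp) ⟩
      valueℕ (suc K) (stepSeq (m + a) s)
        ≡⟨ stepSeq-value (m≤n+m a m) supp ⟩
      valueℕ K s ∎
      where open ≡-Reasoning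

module _ (a b : ℕ) (b<a : b < a) {β βi : ℚ}
         (bβ≡a : fromℕ b ℚ.* β ≡ fromℕ a) (aβi≡b : fromℕ a ℚ.* βi ≡ fromℕ b) where

  open Carry a b b<a
  open Value bβ≡a aβi≡b

  memory : ℕ
  memory = a + b

  Φ : Vec.Vec ℚ (memory + 0 + 1) → ℚ
  Φ w = fromℕ (fromMaybe 0 (List.head (roundsList memory (List.map toℕ (Vec.toList w)))))

  slide-Φ : ∀ u j → slide memory 0 Φ u j ≡ fromℕ (rounds memory (toℕ ∘ u) j)
  slide-Φ u j = cong (fromℕ ∘ fromMaybe 0 ∘ List.head) (begin
    roundsList memory (List.map toℕ (Vec.toList (window memory 0 u j)))
      ≡⟨ cong (roundsList memory ∘ List.map toℕ) (toList-window memory u j) ⟩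
    roundsList memory (List.map toℕ (pastWindow u j (memory + 0 + 1)))
      ≡⟨ cong (roundsList memory) (map-pastWindow toℕ u j (memory + 0 + 1)) ⟩
    roundsList memory (pastWindow (toℕ ∘ u) j (memory + 0 + 1))
      ≡⟨ cong (λ n → roundsList memory (pastWindow (toℕ ∘ u) j (n + 1))) (+-identityʳ memory) ⟩
    roundsList memory (pastWindow (toℕ ∘ u) j (memory + 1))
      ≡⟨ roundsList-pastWindow memory (toℕ ∘ u) j 1 ⟩
    rounds memory (toℕ ∘ u) j ∷ [] ∎)
    where open ≡-Reasoning

  parallelAddition : ParallelAddition β βi (range (a + b))
  parallelAddition =
    slide memory 0 Φ , memory + 0 + 1 , (in-range , keeps-value) , (memory , 0 , refl , Φ , λ _ _ _ → refl)
    where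
    𝒜 : Alphabet
    𝒜 = range (a + b)

    digit-bound : ∀ {u} → u ∈Seq (𝒜 ⊕ 𝒜) → ∀ j → toℕ (u j) < memory + a + b
    digit-bound {u} u∈ j = subst (toℕ (u j) <_) (sym (+-assoc memory a b)) (proj₁ (toℕ-range-⊕ (u∈ j)))

    in-range : ∀ u → u ∈Seq (𝒜 ⊕ 𝒜) → slide memory 0 Φ u ∈Seq 𝒜
    in-range u u∈ j = rounds memory (toℕ ∘ u) j , rounds-< memory (toℕ ∘ u) (digit-bound u∈) j , slide-Φ u j

    keeps-value : ∀ u → u ∈Seq (𝒜 ⊕ 𝒜) → (N : ℕ) → SupportedIn N u →
      ∃[ M ] (SupportedIn M (slide memory 0 Φ u) × value β βi M (slide memory 0 Φ u) ≡ value β βi N u)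
    keeps-value u u∈ N supp = memory + N , supported , (begin
      value β βi (memory + N) (slide memory 0 Φ u)  ≡⟨ value-cong β βi (slide-Φ u) (memory + N) ⟩
      valueℕ (memory + N) (rounds memory (toℕ ∘ u)) ≡⟨ rounds-value memory suppℕ ⟩
      valueℕ N (toℕ ∘ u)                            ≡⟨ value-cong β βi (λ j → proj₂ (toℕ-range-⊕ (u∈ j))) N ⟩
      value β βi N u                                ∎)
      where
      open ≡-Reasoning
      suppℕ : SupportedInℕ N (toℕ ∘ u)
      suppℕ j N<∣j∣ = cong toℕ (supp j N<∣j∣)
      supported : SupportedIn (memory + N) (slide memory 0 Φ u)
      supported j M<∣j∣ = trans (slide-Φ u j) (cong fromℕ (rounds-supported memory suppℕ j M<∣j∣))

proposition40 : (a b : ℕ) .{{_ : NonZero a}} .{{_ : NonZero b}} →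
    Coprime a b → 1 ≤ b → b < a →
    ParallelAddition ((+ a) / b) ((+ b) / a) (range (a + b))
proposition40 zero     b        _ _  ()
proposition40 (suc a′) zero     _ () _
proposition40 (suc a′) (suc b′) _ _  b<a =
  parallelAddition (suc a′) (suc b′) b<a (fromℕ-*-/ (suc a′) b′) (fromℕ-*-/ (suc b′) a′)
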